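{- Let $L$ be a bounded lattice, $\mathrm{V}$ a join-dense set of elements of $L$, and $\Lambda$ a meet-dense set of elements of $L$. For a set $P$ of pairs of elements of $L$, define $\vartriangleleft$ on $P$ by $(a,b)\vartriangleleft(c,d)$ iff $c\not\le b$. Let $\neg a:=a\to0$. (1) If $\to$ is a preimplication on $L$, then with $P=\{(a,a\to b)\mid a,b\in L\}$ there is a complete embedding of $(L,\to)$ into $(\mathfrak{L}(P,\vartriangleleft),\to_\vartriangleleft)$. Moreover, if $\neg$ is an ultraweak pseudocomplementation, then $\vartriangleleft$ is strongly pseudosymmetric. (2) If $\to$ is a protoimplication on $L$, then with $P=\{(a,a\to b)\mid a,b\in L, a\not\le b\}$ there is a complete embedding of $(L,\to)$ into $(\mathfrak{L}(P,\vartriangleleft),\to_\vartriangleleft)$, and $\vartriangleleft$ is reflexive and satisfies right pre-interpolation. Moreover, if $\neg$ is a weak pseudocomplementation, then $\vartriangleleft$ is strongly pseudosymmetric. (3) If $\to$ is an ultraweak pseudoimplication on $L$, then with $P=\{(a,a\to b)\mid a\in\mathrm{V}, b\in L\}\cup\{(1,1\to b)\mid b\in\Lambda\}$ there is a complete embedding of $(L,\to)$ into $(\mathfrak{L}(P,\vartriangleleft),\to_\vartriangleleft)$, and $\vartriangleleft$ satisfies left pre-interpolation. (4) If $\to$ is a weak pseudoimplication on $L$, then with $P=\{(a,a\to b)\mid a\in\mathrm{V}, b\in L, a\not\le b\}$ there is a complete embedding of $(L,\to)$ into $(\mathfrak{L}(P,\vartriangleleft),\to_\vartriangleleft)$, and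 $\vartriangleleft$ is reflexive and satisfies right and left pre-interpolation. Moreover, if $\neg$ is a pseudocomplementation, then $\vartriangleleft$ is weakly compossible. (5) If $\to$ is a relative pseudocomplementation on $L$, then with $P=\{(a,a\to b)\mid a\in\mathrm{V}, b\in\Lambda, a\not\le b\}$ there is a complete embedding of $(L,\to)$ into $(\mathfrak{L}(P,\vartriangleleft),\to_\vartriangleleft)$, and $\vartriangleleft$ is reflexive and compossible. In each case, if $L$ is complete, then the embedding is an isomorphism.
   Context: Join-dense (meet-dense): every element is a join (meet) of a subset. A preimplication on a bounded lattice $L$ is a binary operation $\to$ with, for all $a,b,c$: $a=1\to a$; $a\to(a\to b)\le a\to b$; if $a\le b$ then $b\to c\le a\to c$; if $a\le b$ then $c\to a\le c\to b$. A protoimplication is a preimplication with $b\to b=1$ and $a\wedge(a\to b)\le b$ for all $a,b$. An ultraweak pseudoimplication (resp. weak pseudoimplication) is a preimplication (resp. protoimplication) with $a\le(a\to b)\to b$ for all $a,b$. A relative pseudocomplementation is a protoimplication with: $a\wedge c\le b$ implies $a\le c\to b$. Unary negations: an ultraweak pseudocomplementation is antitone with $a\le\neg\neg a$ and $\neg1=0$; a weak pseudocomplementation is antitone with $a\wedge\neg a=0$ and $a\le\neg\neg a$; a pseudocomplementation sends $a$ to the maximum of $\{y\mid a\wedge y=0\}$. For a nonempty set $X$ with relation $\vartriangleleft$ (write $y\vartriangleright x$ for $x\vartriangleleft y$): $c_\vartriangleleft(A)=\{x\mid\forall x'\vartriangleleft x\ \exists x''\vartriangleright x':x''\in A\}$;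 $\mathfrak{L}(X,\vartriangleleft)$ is the complete lattice of $c_\vartriangleleft$-fixpoints under inclusion (meets are intersections, joins are $c_\vartriangleleft$ of unions); $A\to_\vartriangleleft B=\{x\mid\forall x'\vartriangleleft x\,(x'\in A\Rightarrow\exists x''\vartriangleright x':x''\in B)\}$. $x$ is absurd if no $y$ satisfies $y\vartriangleleft x$. $x$ pre-refines $y$ if $z\vartriangleleft x\Rightarrow z\vartriangleleft y$ for all $z$; $x$ post-refines $y$ if $x\vartriangleleft z\Rightarrow y\vartriangleleft z$ for all $z$; $x$ refines $y$ if it pre-refines and post-refines $y$. $\vartriangleleft$ is strongly pseudosymmetric if for all $x$ and $y\vartriangleleft x$ there is $z\vartriangleleft y$ with $z$ pre-refining $x$ and $x$ pre-refining $z$; satisfies right (resp. left) pre-interpolation if for all $x$ and $y\vartriangleleft x$ there is $z\vartriangleleft x$ (resp. $z\vartriangleleft y$) that post-refines $y$ and pre-refines $x$; is weakly compossible if for all $x$ and $y\vartriangleleft x$ some non-absurd $z$ pre-refines both $y$ and $x$; is compossible if whenever $x\vartriangleleft y$ there is a non-absurd $w$ that refines $x$ and pre-refines $y$. A complete embedding is an injective map preserving all existing meets and joins and commuting with $\to$. -}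

module Defs where

open import Level using (Level; _⊔_) renaming (suc to lsuc)
open import Data.Product using (Σ; ∃; ∃₂; _×_; _,_; proj₁; proj₂)
open import Data.Sum using (_⊎_)
open import Relation.Nullary using (¬_)
open import Relation.Unary using (Pred; _⊆_)
open import Relation.Binary.Lattice.Bundles using (BoundedLattice)

-- Generic notions for a set X with a binary relation _◁_
-- (y ▷ x is written x ◁ y).

module RelDefs {ℓ : Level} {X : Set ℓ} (_◁_ : X → X → Set ℓ) where

  _≐_ : Pred X ℓ → Pred X ℓ → Set ℓ
  A ≐ B = (A ⊆ B) × (B ⊆ A)

  cl : Pred X ℓ → Pred X ℓ
  cl A x = ∀ x' → x' ◁ x → ∃ λ x'' → (x' ◁ x'') × A x''

  _⇒◁_ : Pred X ℓ → Pred X ℓ → Pred X ℓ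
  (A ⇒◁ B) x = ∀ x' → x' ◁ x → A x' → ∃ λ x'' → (x' ◁ x'') × B x''

  -- fixpoints of c_◁ : the carrier of 𝔏(X,◁)
  IsFix : Pred X ℓ → Set ℓ
  IsFix A = cl A ≐ A

  Fix : Set (lsuc ℓ)
  Fix = Σ (Pred X ℓ) IsFix

  Absurd : X → Set ℓ
  Absurd x = ∀ y → ¬ (y ◁ x)

  PreRefines : X → X → Set ℓ
  PreRefines x y = ∀ z → z ◁ x → z ◁ y

  PostRefines : X → X → Set ℓ
  PostRefines x y = ∀ z → x ◁ z → y ◁ z

  Refines : X → X → Set ℓ
  Refines x y = PreRefines x y × PostRefines x y

  IsReflexive : Set ℓ
  IsReflexive = ∀ x → x ◁ x

  StronglyPseudosymmetric : Set ℓ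
  StronglyPseudosymmetric =
    ∀ x y → y ◁ x → ∃ λ z → (z ◁ y) × PreRefines z x × PreRefines x z

  RightPreInterpolation : Set ℓ
  RightPreInterpolation =
    ∀ x y → y ◁ x → ∃ λ z → (z ◁ x) × PostRefines z y × PreRefines z x

  LeftPreInterpolation : Set ℓ
  LeftPreInterpolation =
    ∀ x y → y ◁ x → ∃ λ z → (z ◁ y) × PostRefines z y × PreRefines z x

  WeaklyCompossible : Set ℓ
  WeaklyCompossible =
    ∀ x y → y ◁ x → ∃ λ z → ¬ Absurd z × PreRefines z y × PreRefines z x

  Compossible : Set ℓ
  Compossible =
    ∀ x y → x ◁ y → ∃ λ w → ¬ Absurd w × Refines w x × PreRefines w y

module LatticeDefs {ℓ : Level} (L : BoundedLattice ℓ ℓ ℓ) where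
  open BoundedLattice L renaming (⊤ to 𝟏; ⊥ to 𝟎)

  C = Carrier

  IsUpperBound IsLowerBound IsJoin IsMeet : Pred C ℓ → C → Set ℓ
  IsUpperBound S u = ∀ s → S s → s ≤ u
  IsLowerBound S m = ∀ s → S s → m ≤ s
  IsJoin S j = IsUpperBound S j × (∀ u → IsUpperBound S u → j ≤ u)
  IsMeet S m = IsLowerBound S m × (∀ u → IsLowerBound S u → u ≤ m)

  JoinDense MeetDense : Pred C ℓ → Set (lsuc ℓ)
  JoinDense V = ∀ a → ∃ λ (S : Pred C ℓ) → (S ⊆ V) × IsJoin S a
  MeetDense Λ = ∀ a → ∃ λ (S : Pred C ℓ) → (S ⊆ Λ) × IsMeet S a

  Complete : Set (lsuc ℓ)
  Complete = ∀ (S : Pred C ℓ) → (∃ λ j → IsJoin S j) × (∃ λ m → IsMeet S m)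

  record Preimplication (_⇒_ : C → C → C) : Set ℓ where
    field
      top-⇒    : ∀ a → a ≈ (𝟏 ⇒ a)
      contract : ∀ a b → (a ⇒ (a ⇒ b)) ≤ (a ⇒ b)
      antitone : ∀ a b c → a ≤ b → (b ⇒ c) ≤ (a ⇒ c)
      monotone : ∀ a b c → a ≤ b → (c ⇒ a) ≤ (c ⇒ b)

  record Protoimplication (_⇒_ : C → C → C) : Set ℓ where
    field
      preimplication : Preimplication _⇒_
      refl-⇒         : ∀ b → (b ⇒ b) ≈ 𝟏
      modus-ponens   : ∀ a b → (a ∧ (a ⇒ b)) ≤ b

  record UltraweakPseudoimplication (_⇒_ : C → C → C) : Set ℓ where
    field
      preimplication : Preimplication _⇒_
      double         : ∀ a b → a ≤ ((a ⇒ b) ⇒ b)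

  record WeakPseudoimplication (_⇒_ : C → C → C) : Set ℓ where
    field
      protoimplication : Protoimplication _⇒_
      double           : ∀ a b → a ≤ ((a ⇒ b) ⇒ b)

  record RelativePseudocomplementation (_⇒_ : C → C → C) : Set ℓ where
    field
      protoimplication : Protoimplication _⇒_
      residuation      : ∀ a b c → (a ∧ c) ≤ b → a ≤ (c ⇒ b)

  Antitone : (C → C) → Set ℓ
  Antitone n = ∀ a b → a ≤ b → n b ≤ n a

  UltraweakPseudocomplementation : (C → C) → Set ℓ
  UltraweakPseudocomplementation n =
    Antitone n × (∀ a → a ≤ n (n a)) × (n 𝟏 ≈ 𝟎)

  WeakPseudocomplementation : (C → C) → Set ℓ
  WeakPseudocomplementation n =
    Antitone n × (∀ a → (a ∧ n a) ≈ 𝟎) × (∀ a → a ≤ n (n a))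

  Pseudocomplementation : (C → C) → Set ℓ
  Pseudocomplementation n =
    ∀ a → ((a ∧ n a) ≈ 𝟎) × (∀ y → (a ∧ y) ≈ 𝟎 → y ≤ n a)

  Pair : Set ℓ
  Pair = C × C

  _≈₂_ : Pair → Pair → Set ℓ
  p ≈₂ q = (proj₁ p ≈ proj₁ q) × (proj₂ p ≈ proj₂ q)

  Pt : Pred Pair ℓ → Set ℓ
  Pt P = Σ Pair P

  ◁ : (P : Pred Pair ℓ) → Pt P → Pt P → Set ℓ
  ◁ P ((a , b) , _) ((c , d) , _) = ¬ (c ≤ b)

  P₁ P₂ : (C → C → C) → Pred Pair ℓ
  P₁ _⇒_ p = ∃₂ λ a b → p ≈₂ (a , (a ⇒ b))
  P₂ _⇒_ p = ∃₂ λ a b → ¬ (a ≤ b) × (p ≈₂ (a , (a ⇒ b)))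

  P₃ P₄ P₅ : Pred C ℓ → Pred C ℓ → (C → C → C) → Pred Pair ℓ
  P₃ V Λ _⇒_ p = (∃₂ λ a b → V a × (p ≈₂ (a , (a ⇒ b))))
               ⊎ (∃ λ b → Λ b × (p ≈₂ (𝟏 , (𝟏 ⇒ b))))
  P₄ V Λ _⇒_ p = ∃₂ λ a b → V a × ¬ (a ≤ b) × (p ≈₂ (a , (a ⇒ b)))
  P₅ V Λ _⇒_ p = ∃₂ λ a b → V a × Λ b × ¬ (a ≤ b) × (p ≈₂ (a , (a ⇒ b)))

  module _ (P : Pred Pair ℓ) (_⇒_ : C → C → C) where
    open RelDefs (◁ P)

    IsCompleteEmbedding : (C → Fix) → Set (lsuc ℓ)
    IsCompleteEmbedding e =
      (∀ a b → proj₁ (e a) ≐ proj₁ (e b) → a ≈ b)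
      × (∀ (S : Pred C ℓ) m → IsMeet S m →
           proj₁ (e m) ≐ (λ x → ∀ s → S s → proj₁ (e s) x))
      × (∀ (S : Pred C ℓ) j → IsJoin S j →
           proj₁ (e j) ≐ cl (λ x → ∃ λ s → S s × proj₁ (e s) x))
      × (∀ a b → proj₁ (e (a ⇒ b)) ≐ (proj₁ (e a) ⇒◁ proj₁ (e b)))

    IsSurjective : (C → Fix) → Set (lsuc ℓ)
    IsSurjective e = ∀ (A : Fix) → ∃ λ a → proj₁ (e a) ≐ proj₁ A

    Representation : Set (lsuc ℓ)
    Representation = ∃ λ (e : C → Fix) →
      IsCompleteEmbedding e × (Complete → IsSurjective e)

-- An element a is sent to the set ↓ a of points whose first component lies
-- below a.  Everything reduces to two properties of the chosen set P of
-- pairs (a , a ⇒ b): P is separating (whenever b ≰ v some point x has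
-- fst x ≤ b and fst x ≰ v) and refuting (whenever fst x ≰ a ⇒ b some point y
-- has fst y ≤ a, b ≤ snd y and fst x ≰ snd y).  Separation makes ↓ reflect
-- the order and preserve joins; refutation (at a = 𝟏) makes every ↓ a closed
-- and gives ↓ a ⇒◁ ↓ b ⊆ ↓ (a ⇒ b), while the converse inclusion comes from
-- a ⇒ (a ⇒ c) ≤ a ⇒ c.  A fixpoint A is ↓ of the join of the first
-- components of its points, so ↓ is onto when L is complete.  For the five
-- choices of P the witnesses are produced from join- and meet-density, and
-- the properties of ◁ are read off the same witnesses.
module Submission where

open import Defs
open import Level using (Level)
open import Function using (_∘_)
open import Data.Product using (∃; ∃₂; _×_; _,_; proj₁; proj₂)
open import Data.Sum using (inj₁; inj₂)
open import Relation.Nullary using (¬_)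
open import Relation.Nullary.Decidable using (decidable-stable)
open import Relation.Unary using (Pred; _⊆_)
open import Relation.Binary.Lattice.Bundles using (BoundedLattice)
open import Axiom.ExcludedMiddle using (ExcludedMiddle)

module Construction {ℓ : Level} (em : ExcludedMiddle ℓ) (L : BoundedLattice ℓ ℓ ℓ) where
  open BoundedLattice L renaming (⊤ to 𝟏; ⊥ to 𝟎)
  open LatticeDefs L
  open import Relation.Binary.Reasoning.PartialOrder poset

  ¬¬-elim : {A : Set ℓ} → ¬ ¬ A → A
  ¬¬-elim = decidable-stable em

  ¬∀⇒∃¬ : {A : Set ℓ} {S Q : Pred A ℓ} → ¬ (∀ s → S s → Q s) → ∃ λ s → S s × ¬ Q s
  ¬∀⇒∃¬ ¬all = ¬¬-elim λ none → ¬all λ s s∈S → ¬¬-elim λ ¬Qs → none (s , s∈S , ¬Qs)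

  join-≰ : ∀ {S b v} → IsJoin S b → ¬ b ≤ v → ∃ λ s → S s × ¬ s ≤ v
  join-≰ (_ , least) b≰v = ¬∀⇒∃¬ (b≰v ∘ least _)

  meet-≰ : ∀ {S a x} → IsMeet S a → ¬ x ≤ a → ∃ λ s → S s × ¬ x ≤ s
  meet-≰ (_ , greatest) x≰a = ¬∀⇒∃¬ (x≰a ∘ greatest _)

  joinDense-≰ : ∀ {V} → JoinDense V → ∀ {b v} → ¬ b ≤ v → ∃ λ u → V u × u ≤ b × ¬ u ≤ v
  joinDense-≰ dense {b} b≰v =
    let (S , S⊆V , isJoin) = dense b
        (u , u∈S , u≰v) = join-≰ isJoin b≰v
    in u , S⊆V u∈S , proj₁ isJoin u u∈S , u≰v

  meetDense-≰ : ∀ {Λ} → MeetDense Λ → ∀ {x a} → ¬ x ≤ a → ∃ λ s → Λ s × a ≤ s × ¬ x ≤ s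
  meetDense-≰ dense {a = a} x≰a =
    let (S , S⊆Λ , isMeet) = dense a
        (s , s∈S , x≰s) = meet-≰ isMeet x≰a
    in s , S⊆Λ s∈S , proj₁ isMeet s s∈S , x≰s

  module PreimplicationLemmas {_⇒_ : C → C → C} (pre : Preimplication _⇒_) where
    open Preimplication pre

    weakening : ∀ a b → b ≤ a ⇒ b
    weakening a b = begin
      b       ≈⟨ top-⇒ b ⟩
      𝟏 ⇒ b   ≤⟨ antitone a 𝟏 b (maximum a) ⟩
      a ⇒ b   ∎

    contraction-≈ : ∀ {c d e} → d ≈ c ⇒ e → c ⇒ d ≤ d
    contraction-≈ {c} {d} {e} d≈ = begin
      c ⇒ d         ≤⟨ monotone d (c ⇒ e) c (reflexive d≈) ⟩
      c ⇒ (c ⇒ e)   ≤⟨ contract c e ⟩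
      c ⇒ e         ≈⟨ Eq.sym d≈ ⟩
      d             ∎

  module ProtoimplicationLemmas {_⇒_ : C → C → C} (proto : Protoimplication _⇒_) where
    open Protoimplication proto
    open Preimplication preimplication

    modus-ponens-≤ : ∀ {u y s} → u ≤ y → y ≤ u ⇒ s → u ≤ s
    modus-ponens-≤ {u} {s = s} u≤y y≤ = trans (∧-greatest refl (trans u≤y y≤)) (modus-ponens u s)

    ⇒-self-≰ : ∀ {u e} → ¬ u ≤ e → ¬ u ≤ u ⇒ e
    ⇒-self-≰ u≰e = u≰e ∘ modus-ponens-≤ refl

    pair-irreflexive : ∀ {p q a b} → p ≈ a → q ≈ a ⇒ b → ¬ a ≤ b → ¬ p ≤ q
    pair-irreflexive p≈ q≈ a≰b = ⇒-self-≰ a≰b ∘ ≤-respʳ-≈ q≈ ∘ ≤-respˡ-≈ p≈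

    ⇒-≰-antecedent : ∀ {a b c} → ¬ c ≤ a ⇒ b → ¬ a ≤ b
    ⇒-≰-antecedent {a} {b} {c} c≰ a≤b = c≰ (begin
      c       ≤⟨ maximum c ⟩
      𝟏       ≈⟨ Eq.sym (refl-⇒ b) ⟩
      b ⇒ b   ≤⟨ antitone a b b a≤b ⟩
      a ⇒ b   ∎)

  module Exchange {_⇒_ : C → C → C} (pre : Preimplication _⇒_)
                  (double : ∀ a b → a ≤ (a ⇒ b) ⇒ b) where
    open Preimplication pre

    exchange : ∀ {u c d} → c ≤ u ⇒ d → u ≤ c ⇒ d
    exchange {u} {c} {d} c≤ = trans (double u d) (antitone c (u ⇒ d) d c≤)

    joinDense-⇒-≰ : ∀ {V} → JoinDense V → ∀ {a b y} → ¬ y ≤ a ⇒ b →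
                    ∃ λ u → V u × u ≤ a × ¬ y ≤ u ⇒ b
    joinDense-⇒-≰ dense y≰ =
      let (u , u∈V , u≤a , u≰) = joinDense-≰ dense (y≰ ∘ exchange)
      in u , u∈V , u≤a , u≰ ∘ exchange

  fst snd : {P : Pred Pair ℓ} → Pt P → C
  fst x = proj₁ (proj₁ x)
  snd x = proj₂ (proj₁ x)

  ImplicationPairs : (C → C → C) → Pred Pair ℓ → Set ℓ
  ImplicationPairs _⇒_ P = ∀ (x : Pt P) → ∃₂ λ u c → fst x ≈ u × snd x ≈ u ⇒ c

  module Points {_⇒_ : C → C → C} (pre : Preimplication _⇒_) (P : Pred Pair ℓ)
                (pairs : ImplicationPairs _⇒_ P) where
    open Preimplication pre
    open PreimplicationLemmas pre
    open RelDefs (◁ P)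

    _⊲_ : Pt P → Pt P → Set ℓ
    _⊲_ = ◁ P

    second-absorbs : ∀ y {a b} → fst y ≤ a → b ≤ snd y → a ⇒ b ≤ snd y
    second-absorbs y {a} {b} y≤a b≤y with pairs y
    ... | u , _ , fst≈ , snd≈ = begin
      a ⇒ b       ≤⟨ antitone u a b (≤-respˡ-≈ fst≈ y≤a) ⟩
      u ⇒ b       ≤⟨ monotone b (snd y) u b≤y ⟩
      u ⇒ snd y   ≤⟨ contraction-≈ snd≈ ⟩
      snd y       ∎

    implication-◁ : ∀ x y → y ⊲ x → ¬ fst x ≤ fst y ⇒ snd y
    implication-◁ _ y y◁x x≤ = y◁x (trans x≤ (second-absorbs y refl refl))

    negation-◁ : Antitone (λ a → a ⇒ 𝟎) → (∀ a → a ≤ (a ⇒ 𝟎) ⇒ 𝟎) →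
                 ∀ x y → y ⊲ x → ¬ fst y ≤ fst x ⇒ 𝟎
    negation-◁ ¬-antitone ≤¬¬ x y y◁x y≤¬x = y◁x (begin
      fst x             ≤⟨ ≤¬¬ (fst x) ⟩
      (fst x ⇒ 𝟎) ⇒ 𝟎   ≤⟨ ¬-antitone _ _ y≤¬x ⟩
      fst y ⇒ 𝟎         ≤⟨ second-absorbs y refl (minimum _) ⟩
      snd y             ∎)

    preRefines-≤ : ∀ z x → fst z ≤ fst x → PreRefines z x
    preRefines-≤ _ _ z≤x _ w◁z x≤w = w◁z (trans z≤x x≤w)

    postRefines-≤ : ∀ z y → snd y ≤ snd z → PostRefines z y
    postRefines-≤ _ _ y≤z _ z◁w w≤y = z◁w (trans w≤y y≤z)

    Separating : Set ℓ
    Separating = ∀ {b v} → ¬ b ≤ v → ∃ λ (x : Pt P) → fst x ≤ b × ¬ fst x ≤ v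

    Refuting : Set ℓ
    Refuting = ∀ {a b} (x : Pt P) → ¬ fst x ≤ a ⇒ b →
               ∃ λ (y : Pt P) → fst y ≤ a × b ≤ snd y × ¬ fst x ≤ snd y

    firsts : Pred (Pt P) ℓ → Pred C ℓ
    firsts A c = ∃ λ (y : Pt P) → A y × fst y ≈ c

    -- ↓ a x unfolds to fst x ≤ a, which does not determine x; this is why
    -- inclusions between such sets are eta-expanded by hand below.
    infix 30 ↓_
    ↓_ : C → Pred (Pt P) ℓ
    (↓ a) x = fst x ≤ a

    module _ (separating : Separating) (refuting : Refuting) where

      refuting-𝟏 : ∀ {a} (x : Pt P) → ¬ fst x ≤ a → ∃ λ (y : Pt P) → a ≤ snd y × ¬ fst x ≤ snd y
      refuting-𝟏 {a} x x≰a =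
        let (y , _ , a≤y , x≰y) = refuting x (x≰a ∘ ≤-respʳ-≈ (Eq.sym (top-⇒ a)))
        in y , a≤y , x≰y

      cl-bounded : ∀ {A : Pred (Pt P) ℓ} {a} → (∀ y → A y → fst y ≤ a) → ∀ x → cl A x → fst x ≤ a
      cl-bounded bound x x∈clA = ¬¬-elim λ x≰a →
        let (y , a≤y , x≰y) = refuting-𝟏 x x≰a
            (z , y◁z , z∈A) = x∈clA y x≰y
        in y◁z (trans (bound z z∈A) a≤y)

      ↓-closed : ∀ a → IsFix (↓ a)
      ↓-closed a = (λ {x} → cl-bounded (λ _ y≤a → y≤a) x) , λ {x} x≤a _ x′◁x → x , x′◁x , x≤a

      ↓-fix : C → Fix
      ↓-fix a = ↓ a , ↓-closed a

      ↓-reflects-≤ : ∀ {a b} → ↓ a ⊆ ↓ b → a ≤ b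
      ↓-reflects-≤ a⊆b = ¬¬-elim λ a≰b →
        let (x , x≤a , x≰b) = separating a≰b in x≰b (a⊆b {x} x≤a)

      ↓-injective : ∀ a b → ↓ a ≐ ↓ b → a ≈ b
      ↓-injective a b (a⊆b , b⊆a) = antisym (↓-reflects-≤ (λ {x} → a⊆b {x})) (↓-reflects-≤ (λ {x} → b⊆a {x}))

      ↓-meet : ∀ S m → IsMeet S m → ↓ m ≐ (λ x → ∀ s → S s → (↓ s) x)
      ↓-meet _ _ (lower , greatest) =
        (λ x≤m s s∈S → trans x≤m (lower s s∈S)) , greatest _

      ↓-join : ∀ S j → IsJoin S j → ↓ j ≐ cl (λ x → ∃ λ s → S s × (↓ s) x)
      ↓-join S j isJoin@(upper , _) =
        (λ {x} → below {x}) , λ {x} → cl-bounded (λ { _ (s , s∈S , y≤s) → trans y≤s (upper s s∈S) }) x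
        where
        below : ↓ j ⊆ cl (λ x → ∃ λ s → S s × (↓ s) x)
        below {x} x≤j _ y◁x =
          let (s , s∈S , s≰y) = join-≰ isJoin (y◁x ∘ trans x≤j)
              (z , z≤s , z≰y) = separating s≰y
          in z , z≰y , s , s∈S , z≤s

      ↓-⇒ : ∀ a b → ↓ (a ⇒ b) ≐ (↓ a ⇒◁ ↓ b)
      ↓-⇒ a b = (λ {x} → sound {x}) , (λ {x} → complete {x})
        where
        sound : ↓ (a ⇒ b) ⊆ (↓ a ⇒◁ ↓ b)
        sound {x} x≤a⇒b y y◁x y≤a =
          let (z , z≤b , z≰y) = separating (y◁x ∘ trans x≤a⇒b ∘ second-absorbs y y≤a)
          in z , z≰y , z≤b
        complete : (↓ a ⇒◁ ↓ b) ⊆ ↓ (a ⇒ b)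
        complete {x} x∈ = ¬¬-elim λ x≰ →
          let (y , y≤a , b≤y , x≰y) = refuting x x≰
              (z , y◁z , z≤b) = x∈ y x≰y y≤a
          in y◁z (trans z≤b b≤y)

      ↓-surjective : Complete → IsSurjective P _⇒_ ↓-fix
      ↓-surjective complete (A , A-closed) =
        let (a , isJoin) = proj₁ (complete (firsts A))
            ↓a⊆A : ↓ a ⊆ A
            ↓a⊆A x≤a = proj₁ A-closed λ y y◁x →
              let (c , (z , z∈A , fst≈) , c≰y) = join-≰ isJoin (y◁x ∘ trans x≤a)
              in z , c≰y ∘ ≤-respˡ-≈ fst≈ , z∈A
            A⊆↓a : A ⊆ ↓ a
            A⊆↓a {x} x∈A = proj₁ isJoin (fst x) (x , x∈A , Eq.refl)
        in a , ↓a⊆A , A⊆↓a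

      representation : Representation P _⇒_
      representation = ↓-fix , (↓-injective , ↓-meet , ↓-join , ↓-⇒) , ↓-surjective

  module OfPreimplication {_⇒_ : C → C → C} (pre : Preimplication _⇒_) where
    open PreimplicationLemmas pre

    point : C → C → Pt (P₁ _⇒_)
    point a b = (a , a ⇒ b) , a , b , Eq.refl , Eq.refl

    pairs : ImplicationPairs _⇒_ (P₁ _⇒_)
    pairs (_ , a , b , fst≈ , snd≈) = a , b , fst≈ , snd≈

    open Points pre (P₁ _⇒_) pairs hiding (representation)
    open RelDefs (◁ (P₁ _⇒_))

    separating : Separating
    separating {b} {v} b≰v = point b v , refl , b≰v

    refuting : Refuting
    refuting {a} {b} _ x≰ = point a b , refl , weakening a b , x≰

    representation : Representation (P₁ _⇒_) _⇒_
    representation = Points.representation pre (P₁ _⇒_) pairs separating refuting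

    stronglyPseudosymmetric : UltraweakPseudocomplementation (λ a → a ⇒ 𝟎) → StronglyPseudosymmetric
    stronglyPseudosymmetric (¬-antitone , ≤¬¬ , _) x y y◁x =
      let z = point (fst x) 𝟎
      in z , negation-◁ ¬-antitone ≤¬¬ x y y◁x , preRefines-≤ z x refl , preRefines-≤ x z refl

  module OfProtoimplication {_⇒_ : C → C → C} (proto : Protoimplication _⇒_) where
    open Protoimplication proto
    open PreimplicationLemmas preimplication
    open ProtoimplicationLemmas proto

    point : ∀ a b → ¬ a ≤ b → Pt (P₂ _⇒_)
    point a b a≰b = (a , a ⇒ b) , a , b , a≰b , Eq.refl , Eq.refl

    pairs : ImplicationPairs _⇒_ (P₂ _⇒_)
    pairs (_ , a , b , _ , fst≈ , snd≈) = a , b , fst≈ , snd≈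

    open Points preimplication (P₂ _⇒_) pairs hiding (representation)
    open RelDefs (◁ (P₂ _⇒_))

    separating : Separating
    separating {b} {v} b≰v = point b v b≰v , refl , b≰v

    refuting : Refuting
    refuting {a} {b} _ x≰ = point a b (⇒-≰-antecedent x≰) , refl , weakening a b , x≰

    representation : Representation (P₂ _⇒_) _⇒_
    representation = Points.representation preimplication (P₂ _⇒_) pairs separating refuting

    ◁-reflexive : IsReflexive
    ◁-reflexive (_ , _ , _ , a≰b , fst≈ , snd≈) = pair-irreflexive fst≈ snd≈ a≰b

    rightPreInterpolation : RightPreInterpolation
    rightPreInterpolation x y y◁x =
      let z = point (fst x) (snd y) y◁x
      in z , ⇒-self-≰ y◁x , postRefines-≤ z y (weakening _ _) , preRefines-≤ z x refl

    stronglyPseudosymmetric : WeakPseudocomplementation (λ a → a ⇒ 𝟎) → StronglyPseudosymmetric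
    stronglyPseudosymmetric (¬-antitone , _ , ≤¬¬) x y y◁x =
      let z = point (fst x) 𝟎 (y◁x ∘ λ x≤𝟎 → trans x≤𝟎 (minimum _))
      in z , negation-◁ ¬-antitone ≤¬¬ x y y◁x , preRefines-≤ z x refl , preRefines-≤ x z refl

  module OfUltraweakPseudoimplication (V Λ : Pred C ℓ) (V-dense : JoinDense V)
      {_⇒_ : C → C → C} (uw : UltraweakPseudoimplication _⇒_) where
    open UltraweakPseudoimplication uw
    open PreimplicationLemmas preimplication
    open Exchange preimplication double

    point : ∀ {a} b → V a → Pt (P₃ V Λ _⇒_)
    point {a} b a∈V = (a , a ⇒ b) , inj₁ (a , b , a∈V , Eq.refl , Eq.refl)

    pairs : ImplicationPairs _⇒_ (P₃ V Λ _⇒_)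
    pairs (_ , inj₁ (a , b , _ , fst≈ , snd≈)) = a , b , fst≈ , snd≈
    pairs (_ , inj₂ (b , _ , fst≈ , snd≈))     = 𝟏 , b , fst≈ , snd≈

    open Points preimplication (P₃ V Λ _⇒_) pairs hiding (representation)
    open RelDefs (◁ (P₃ V Λ _⇒_))

    separating : Separating
    separating {v = v} b≰v =
      let (u , u∈V , u≤b , u≰v) = joinDense-≰ V-dense b≰v in point v u∈V , u≤b , u≰v

    refuting : Refuting
    refuting {b = b} _ x≰ =
      let (u , u∈V , u≤a , x≰u⇒b) = joinDense-⇒-≰ V-dense x≰
      in point b u∈V , u≤a , weakening _ b , x≰u⇒b

    representation : Representation (P₃ V Λ _⇒_) _⇒_
    representation = Points.representation preimplication (P₃ V Λ _⇒_) pairs separating refuting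

    leftPreInterpolation : LeftPreInterpolation
    leftPreInterpolation x y y◁x =
      let (u , u∈V , u≤x , u≰) = joinDense-≰ V-dense (implication-◁ x y y◁x)
          z = point (snd y) u∈V
      in z , u≰ ∘ exchange , postRefines-≤ z y (weakening _ _) , preRefines-≤ z x u≤x

  module OfWeakPseudoimplication (V Λ : Pred C ℓ) (V-dense : JoinDense V)
      {_⇒_ : C → C → C} (wp : WeakPseudoimplication _⇒_) where
    open WeakPseudoimplication wp
    open Protoimplication protoimplication
    open PreimplicationLemmas preimplication
    open ProtoimplicationLemmas protoimplication
    open Exchange preimplication double

    point : ∀ {a} b → V a → ¬ a ≤ b → Pt (P₄ V Λ _⇒_)
    point {a} b a∈V a≰b = (a , a ⇒ b) , a , b , a∈V , a≰b , Eq.refl , Eq.refl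

    pairs : ImplicationPairs _⇒_ (P₄ V Λ _⇒_)
    pairs (_ , a , b , _ , _ , fst≈ , snd≈) = a , b , fst≈ , snd≈

    open Points preimplication (P₄ V Λ _⇒_) pairs hiding (representation)
    open RelDefs (◁ (P₄ V Λ _⇒_))

    separating : Separating
    separating {v = v} b≰v =
      let (u , u∈V , u≤b , u≰v) = joinDense-≰ V-dense b≰v in point v u∈V u≰v , u≤b , u≰v

    refuting : Refuting
    refuting {b = b} _ x≰ =
      let (u , u∈V , u≤a , x≰u⇒b) = joinDense-⇒-≰ V-dense x≰
      in point b u∈V (⇒-≰-antecedent x≰u⇒b) , u≤a , weakening _ b , x≰u⇒b

    representation : Representation (P₄ V Λ _⇒_) _⇒_
    representation = Points.representation preimplication (P₄ V Λ _⇒_) pairs separating refuting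

    ◁-reflexive : IsReflexive
    ◁-reflexive (_ , _ , _ , _ , a≰b , fst≈ , snd≈) = pair-irreflexive fst≈ snd≈ a≰b

    rightPreInterpolation : RightPreInterpolation
    rightPreInterpolation x@(_ , a , _ , a∈V , _ , fst≈ , _) y y◁x =
      let a≰y = y◁x ∘ ≤-respˡ-≈ (Eq.sym fst≈)
          z = point (snd y) a∈V a≰y
      in z , ⇒-self-≰ a≰y ∘ ≤-respˡ-≈ fst≈ ,
         postRefines-≤ z y (weakening _ _) , preRefines-≤ z x (reflexive (Eq.sym fst≈))

    leftPreInterpolation : LeftPreInterpolation
    leftPreInterpolation x y y◁x =
      let (u , u∈V , u≤x , u≰) = joinDense-≰ V-dense (implication-◁ x y y◁x)
          z = point (snd y) u∈V (u≰ ∘ λ u≤y → trans u≤y (weakening _ _))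
      in z , u≰ ∘ exchange , postRefines-≤ z y (weakening _ _) , preRefines-≤ z x u≤x

    weaklyCompossible : Pseudocomplementation (λ a → a ⇒ 𝟎) → WeaklyCompossible
    weaklyCompossible pseudo x y y◁x =
      let (u , u∈V , u≤y∧x , u≰𝟎) = joinDense-≰ V-dense y∧x≰𝟎
          z = point 𝟎 u∈V u≰𝟎
      in z , (λ z-absurd → z-absurd z (⇒-self-≰ u≰𝟎)) ,
         preRefines-≤ z y (trans u≤y∧x (x∧y≤x _ _)) , preRefines-≤ z x (trans u≤y∧x (x∧y≤y _ _))
      where
      y∧x≰𝟎 : ¬ fst y ∧ fst x ≤ 𝟎
      y∧x≰𝟎 y∧x≤𝟎 = y◁x (begin
        fst x       ≤⟨ proj₂ (pseudo (fst y)) (fst x) (antisym y∧x≤𝟎 (minimum _)) ⟩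
        fst y ⇒ 𝟎   ≤⟨ second-absorbs y refl (minimum _) ⟩
        snd y       ∎)

  module OfRelativePseudocomplementation (V Λ : Pred C ℓ)
      (V-dense : JoinDense V) (Λ-dense : MeetDense Λ)
      {_⇒_ : C → C → C} (rpc : RelativePseudocomplementation _⇒_) where
    open RelativePseudocomplementation rpc
    open Protoimplication protoimplication
    open Preimplication preimplication using (antitone)
    open PreimplicationLemmas preimplication
    open ProtoimplicationLemmas protoimplication

    point : ∀ {a b} → V a → Λ b → ¬ a ≤ b → Pt (P₅ V Λ _⇒_)
    point {a} {b} a∈V b∈Λ a≰b = (a , a ⇒ b) , a , b , a∈V , b∈Λ , a≰b , Eq.refl , Eq.refl

    pairs : ImplicationPairs _⇒_ (P₅ V Λ _⇒_)
    pairs (_ , a , b , _ , _ , _ , fst≈ , snd≈) = a , b , fst≈ , snd≈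

    open Points preimplication (P₅ V Λ _⇒_) pairs hiding (representation)
    open RelDefs (◁ (P₅ V Λ _⇒_))

    separating : Separating
    separating b≰v =
      let (u , u∈V , u≤b , u≰v) = joinDense-≰ V-dense b≰v
          (s , s∈Λ , _ , u≰s) = meetDense-≰ Λ-dense u≰v
      in point u∈V s∈Λ u≰s , u≤b , u≰v

    refuting : Refuting
    refuting {a} {b} x x≰ =
      let (s , s∈Λ , b≤s , x∧a≰s) = meetDense-≰ Λ-dense (x≰ ∘ residuation (fst x) b a)
          (u , u∈V , u≤x∧a , u≰s) = joinDense-≰ V-dense x∧a≰s
      in point u∈V s∈Λ u≰s , trans u≤x∧a (x∧y≤y _ _) , trans b≤s (weakening _ s) ,
         u≰s ∘ modus-ponens-≤ (trans u≤x∧a (x∧y≤x _ _))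

    representation : Representation (P₅ V Λ _⇒_) _⇒_
    representation = Points.representation preimplication (P₅ V Λ _⇒_) pairs separating refuting

    ◁-reflexive : IsReflexive
    ◁-reflexive (_ , _ , _ , _ , _ , a≰b , fst≈ , snd≈) = pair-irreflexive fst≈ snd≈ a≰b

    compossible : Compossible
    compossible x@(_ , c , e , _ , e∈Λ , _ , fst≈ , snd≈) y x◁y =
      let (u , u∈V , u≤y∧c , u≰e) = joinDense-≰ V-dense y∧c≰e
          w = point u∈V e∈Λ u≰e
          u≤c = trans u≤y∧c (x∧y≤y _ _)
      in w , (λ w-absurd → w-absurd w (⇒-self-≰ u≰e)) ,
         (preRefines-≤ w x (≤-respʳ-≈ (Eq.sym fst≈) u≤c) ,
          postRefines-≤ w x (≤-respˡ-≈ (Eq.sym snd≈) (antitone u c e u≤c))) ,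
         preRefines-≤ w y (trans u≤y∧c (x∧y≤x _ _))
      where
      y∧c≰e : ¬ fst y ∧ c ≤ e
      y∧c≰e = x◁y ∘ ≤-respʳ-≈ (Eq.sym snd≈) ∘ residuation (fst y) e c

theoremB6 : {ℓ : Level} → ExcludedMiddle ℓ →
  (L : BoundedLattice ℓ ℓ ℓ) →
  let open BoundedLattice L renaming (⊥ to 𝟎) in
  let open LatticeDefs L in
  (V Λ : Pred Carrier ℓ) → JoinDense V → MeetDense Λ →
  (∀ (_⇒_ : Carrier → Carrier → Carrier) → Preimplication _⇒_ →
    Representation (P₁ _⇒_) _⇒_
    × (UltraweakPseudocomplementation (λ a → a ⇒ 𝟎) →
        RelDefs.StronglyPseudosymmetric (◁ (P₁ _⇒_))))
  × (∀ (_⇒_ : Carrier → Carrier → Carrier) → Protoimplication _⇒_ →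
    Representation (P₂ _⇒_) _⇒_
    × RelDefs.IsReflexive (◁ (P₂ _⇒_))
    × RelDefs.RightPreInterpolation (◁ (P₂ _⇒_))
    × (WeakPseudocomplementation (λ a → a ⇒ 𝟎) →
        RelDefs.StronglyPseudosymmetric (◁ (P₂ _⇒_))))
  × (∀ (_⇒_ : Carrier → Carrier → Carrier) → UltraweakPseudoimplication _⇒_ →
    Representation (P₃ V Λ _⇒_) _⇒_
    × RelDefs.LeftPreInterpolation (◁ (P₃ V Λ _⇒_)))
  × (∀ (_⇒_ : Carrier → Carrier → Carrier) → WeakPseudoimplication _⇒_ →
    Representation (P₄ V Λ _⇒_) _⇒_
    × RelDefs.IsReflexive (◁ (P₄ V Λ _⇒_))
    × RelDefs.RightPreInterpolation (◁ (P₄ V Λ _⇒_))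
    × RelDefs.LeftPreInterpolation (◁ (P₄ V Λ _⇒_))
    × (Pseudocomplementation (λ a → a ⇒ 𝟎) →
        RelDefs.WeaklyCompossible (◁ (P₄ V Λ _⇒_))))
  × (∀ (_⇒_ : Carrier → Carrier → Carrier) → RelativePseudocomplementation _⇒_ →
    Representation (P₅ V Λ _⇒_) _⇒_
    × RelDefs.IsReflexive (◁ (P₅ V Λ _⇒_))
    × RelDefs.Compossible (◁ (P₅ V Λ _⇒_)))
theoremB6 em L V Λ V-dense Λ-dense =
  (λ _ pre → OfPreimplication.representation pre , OfPreimplication.stronglyPseudosymmetric pre) ,
  (λ _ proto → let open OfProtoimplication proto in
     representation , ◁-reflexive , rightPreInterpolation , stronglyPseudosymmetric) ,
  (λ _ uw → let open OfUltraweakPseudoimplication V Λ V-dense uw in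
     representation , leftPreInterpolation) ,
  (λ _ wp → let open OfWeakPseudoimplication V Λ V-dense wp in
     representation , ◁-reflexive , rightPreInterpolation , leftPreInterpolation , weaklyCompossible) ,
  (λ _ rpc → let open OfRelativePseudocomplementation V Λ V-dense Λ-dense rpc in
     representation , ◁-reflexive , compossible)
  where open Construction em L
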